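{- Let $\langle A,\land,\lor,\to,\sim,1\rangle$ be a Nelson algebra, and define $x\rightarrowtail y:=(x\to y)\land(\sim y\to\sim x)$, $x\land_B y:=x\land y$, $0:=\sim 1$, $\sim_B x:=x\rightarrowtail 0$, $x\lor_B y:=((x\rightarrowtail 0)\land_B(y\rightarrowtail 0))\rightarrowtail 0$. Then for all $x,y,z\in A$: (a) $\sim_B x=\sim x$; (b) $x\lor_B y=x\lor y$; (c) $x\land(x\lor_B y)=x$, $x\land(y\lor_B z)=(z\land x)\lor_B(y\land x)$, and $(x\land\sim_B x)\land(y\lor_B\sim_B y)=x\land\sim_B x$; (d) $x\rightarrowtail x=1$; (e) $x=x\land(\sim x\to y)$; (f) $1\rightarrowtail x=x$; (g) $(x\rightarrowtail x)\rightarrowtail y=y$; (h) $(x\rightarrowtail y)\land y=y$; (i) $x\land\sim(x\land\sim y)=x\land(x\rightarrowtail y)$; (j) $x\rightarrowtail(y\land z)=(x\rightarrowtail y)\land(x\rightarrowtail z)$; (k) $x\rightarrowtail y=\sim_B y\rightarrowtail\sim_B x$; (l) $x\rightarrowtail(x\rightarrowtail(y\rightarrowtail(y\rightarrowtail z)))=(x\land y)\rightarrowtail((x\land y)\rightarrowtail z)$; (m) $\sim(\sim x\land y)\rightarrowtail(x\rightarrowtail y)=x\rightarrowtail y$.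
   Context: A Nelson algebra is an algebra $\langle A,\land,\lor,\to,\sim,1\rangle$ of type $(2,2,2,1,0)$ satisfying, for all $x,y,z$: (N1) $x\land(x\lor y)=x$; (N2) $x\land(y\lor z)=(z\land x)\lor(y\land x)$; (N3) $\sim\sim x=x$; (N4) $\sim(x\land y)=\sim x\lor\sim y$; (N5) $x\land\sim x=(x\land\sim x)\land(y\lor\sim y)$; (N6) $x\to x=1$; (N7) $x\land(x\to y)=x\land(\sim x\lor y)$; (N8) $(x\land y)\to z=x\to(y\to z)$. -}

module Defs where

open import Level using (Level; suc)
open import Relation.Binary.PropositionalEquality using (_≡_)
open import Data.Product using (_×_)

record NelsonAlgebra (a : Level) : Set (suc a) where
  infixr 8 _∧_
  infixr 7 _∨_
  infixr 6 _⇒_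
  field
    Carrier : Set a
    _∧_ _∨_ _⇒_ : Carrier → Carrier → Carrier
    ∼_ : Carrier → Carrier
    𝟏 : Carrier
    N1 : ∀ x y → x ∧ (x ∨ y) ≡ x
    N2 : ∀ x y z → x ∧ (y ∨ z) ≡ (z ∧ x) ∨ (y ∧ x)
    N3 : ∀ x → ∼ (∼ x) ≡ x
    N4 : ∀ x y → ∼ (x ∧ y) ≡ (∼ x) ∨ (∼ y)
    N5 : ∀ x y → x ∧ (∼ x) ≡ (x ∧ (∼ x)) ∧ (y ∨ (∼ y))
    N6 : ∀ x → x ⇒ x ≡ 𝟏
    N7 : ∀ x y → x ∧ (x ⇒ y) ≡ x ∧ ((∼ x) ∨ y)
    N8 : ∀ x y z → (x ∧ y) ⇒ z ≡ x ⇒ (y ⇒ z)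

  infixr 6 _↣_
  _↣_ : Carrier → Carrier → Carrier
  x ↣ y = (x ⇒ y) ∧ ((∼ y) ⇒ (∼ x))

  _∧B_ : Carrier → Carrier → Carrier
  x ∧B y = x ∧ y

  𝟎 : Carrier
  𝟎 = ∼ 𝟏

  ∼B_ : Carrier → Carrier
  ∼B x = x ↣ 𝟎

  _∨B_ : Carrier → Carrier → Carrier
  x ∨B y = ((x ↣ 𝟎) ∧B (y ↣ 𝟎)) ↣ 𝟎

module _ {a : Level} (N : NelsonAlgebra a) where
  open NelsonAlgebra N

  Theorem6 : Set a
  Theorem6 = ∀ x y z →
      ((∼B x) ≡ (∼ x))
    × ((x ∨B y) ≡ (x ∨ y))
    × ((x ∧ (x ∨B y) ≡ x)
       × (x ∧ (y ∨B z) ≡ (z ∧ x) ∨B (y ∧ x))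
       × ((x ∧ (∼B x)) ∧ (y ∨B (∼B y)) ≡ x ∧ (∼B x)))
    × ((x ↣ x) ≡ 𝟏)
    × (x ≡ x ∧ ((∼ x) ⇒ y))
    × ((𝟏 ↣ x) ≡ x)
    × (((x ↣ x) ↣ y) ≡ y)
    × ((x ↣ y) ∧ y ≡ y)
    × (x ∧ (∼ (x ∧ (∼ y))) ≡ x ∧ (x ↣ y))
    × ((x ↣ (y ∧ z)) ≡ (x ↣ y) ∧ (x ↣ z))
    × ((x ↣ y) ≡ ((∼B y) ↣ (∼B x)))
    × ((x ↣ (x ↣ (y ↣ (y ↣ z)))) ≡ ((x ∧ y) ↣ ((x ∧ y) ↣ z)))
    × (((∼ ((∼ x) ∧ y)) ↣ (x ↣ y)) ≡ (x ↣ y))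

-- (N1) and (N2) are Sholander's axioms for a distributive lattice, and with (N3)–(N5) the
-- algebra is a Kleene lattice. The weak implication ⇒ is a Heyting implication for the
-- preorder x ⊑ y :⇔ x ⇒ y ≡ 𝟏, and equality is recovered from it: x ≡ y as soon as x and y
-- are ⊑-equivalent and so are ∼ x and ∼ y. Since ∼ (x ⇒ y) is ⊑-equivalent to x ∧ ∼ y,
-- each identity reduces to Heyting reasoning about ⊑, once for the terms and once for
-- their negations.
module Submission where

open import Level using (Level)
open import Algebra.Core using (Op₂)
open import Data.Product using (_×_; _,_; proj₁; swap)
open import Relation.Binary.Bundles using (Preorder)
open import Relation.Binary.Structures using (IsEquivalence; IsPreorder)
import Relation.Binary.Reasoning.Preorder
open import Relation.Binary.PropositionalEquality
open import Defs

module SholanderLattice {a} {A : Set a} (_∧_ _∨_ : Op₂ A)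
  (absorb : ∀ x y → (x ∧ (x ∨ y)) ≡ x)
  (distrib : ∀ x y z → (x ∧ (y ∨ z)) ≡ ((z ∧ x) ∨ (y ∧ x))) where

  open import Algebra.Definitions (_≡_ {A = A})

  private
    self-split : ∀ x → x ≡ ((x ∧ x) ∨ (x ∧ x))
    self-split x = trans (sym (absorb x x)) (distrib x x x)

  ∧-idem : Idempotent _∧_
  ∧-idem x = begin
    x ∧ x                         ≡⟨ cong (x ∧_) (self-split x) ⟩
    x ∧ ((x ∧ x) ∨ (x ∧ x))       ≡⟨ distrib x (x ∧ x) (x ∧ x) ⟩
    ((x ∧ x) ∧ x) ∨ ((x ∧ x) ∧ x) ≡⟨ cong₂ _∨_ xx∧x≡xx xx∧x≡xx ⟩
    (x ∧ x) ∨ (x ∧ x)             ≡⟨ self-split x ⟨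
    x                             ∎
    where
    open ≡-Reasoning
    xx∧x≡xx : ((x ∧ x) ∧ x) ≡ (x ∧ x)
    xx∧x≡xx = trans (cong ((x ∧ x) ∧_) (self-split x)) (absorb (x ∧ x) (x ∧ x))

  ∨-idem : Idempotent _∨_
  ∨-idem x = sym (trans (self-split x) (cong₂ _∨_ (∧-idem x) (∧-idem x)))

  ∧-comm : Commutative _∧_
  ∧-comm x y = trans (cong (x ∧_) (sym (∨-idem y))) (trans (distrib x y y) (∨-idem (y ∧ x)))

  private
    ∧-absorbedʳ : ∀ x y → ((y ∧ x) ∨ x) ≡ x
    ∧-absorbedʳ x y = begin
      (y ∧ x) ∨ x       ≡⟨ cong ((y ∧ x) ∨_) (∧-idem x) ⟨
      (y ∧ x) ∨ (x ∧ x) ≡⟨ distrib x x y ⟨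
      x ∧ (x ∨ y)       ≡⟨ absorb x y ⟩
      x                 ∎
      where open ≡-Reasoning

    ∧-absorbedˡ : ∀ x y → ((x ∧ y) ∨ x) ≡ x
    ∧-absorbedˡ x y = trans (cong (_∨ x) (∧-comm x y)) (∧-absorbedʳ x y)

  ∧-contract : ∀ x y → (x ∧ (x ∧ y)) ≡ (x ∧ y)
  ∧-contract x y = begin
    x ∧ (x ∧ y)             ≡⟨ cong (_∧ (x ∧ y)) (∧-absorbedˡ x y) ⟨
    ((x ∧ y) ∨ x) ∧ (x ∧ y) ≡⟨ ∧-comm _ _ ⟩
    (x ∧ y) ∧ ((x ∧ y) ∨ x) ≡⟨ absorb (x ∧ y) x ⟩
    x ∧ y                   ∎
    where open ≡-Reasoning

  ∨-absorbs-∧ : ∀ x y → (x ∨ (x ∧ y)) ≡ x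
  ∨-absorbs-∧ x y = begin
    x ∨ (x ∧ y)             ≡⟨ cong₂ _∨_ (∧-idem x) (trans (∧-comm (x ∧ y) x) (∧-contract x y)) ⟨
    (x ∧ x) ∨ ((x ∧ y) ∧ x) ≡⟨ distrib x (x ∧ y) x ⟨
    x ∧ ((x ∧ y) ∨ x)       ≡⟨ cong (x ∧_) (∧-absorbedˡ x y) ⟩
    x ∧ x                   ≡⟨ ∧-idem x ⟩
    x                       ∎
    where open ≡-Reasoning

  private
    ∧-absorbs-∨ʳ : ∀ x y → (x ∧ (y ∨ x)) ≡ x
    ∧-absorbs-∨ʳ x y = trans (distrib x y x)
      (trans (cong₂ _∨_ (∧-idem x) (∧-comm y x)) (∨-absorbs-∧ x y))

  ∨-comm : Commutative _∨_
  ∨-comm x y = begin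
    x ∨ y                             ≡⟨ ∧-idem (x ∨ y) ⟨
    (x ∨ y) ∧ (x ∨ y)                 ≡⟨ distrib (x ∨ y) x y ⟩
    (y ∧ (x ∨ y)) ∨ (x ∧ (x ∨ y))     ≡⟨ cong₂ _∨_ (∧-absorbs-∨ʳ y x) (absorb x y) ⟩
    y ∨ x                             ∎
    where open ≡-Reasoning

  ∧-distribˡ-∨ : _∧_ DistributesOverˡ _∨_
  ∧-distribˡ-∨ x y z =
    trans (distrib x y z) (trans (cong₂ _∨_ (∧-comm z x) (∧-comm y x)) (∨-comm _ _))

  ∧-distribʳ-∨ : _∧_ DistributesOverʳ _∨_
  ∧-distribʳ-∨ x y z = trans (∧-comm (y ∨ z) x) (trans (distrib x y z) (∨-comm _ _))

  infix 4 _≤_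
  _≤_ : A → A → Set a
  x ≤ y = (x ∧ y) ≡ x

  ∨≡⇒≤ : ∀ {x y} → (x ∨ y) ≡ y → x ≤ y
  ∨≡⇒≤ {x} {y} x∨y≡y = trans (cong (x ∧_) (sym x∨y≡y)) (absorb x y)

  ≤⇒∨≡ : ∀ {x y} → x ≤ y → (x ∨ y) ≡ y
  ≤⇒∨≡ {x} {y} x≤y = trans (cong (_∨ y) (sym x≤y)) (∧-absorbedʳ y x)

  ≤⇒∧≡ʳ : ∀ {x y} → x ≤ y → (y ∧ x) ≡ x
  ≤⇒∧≡ʳ {x} {y} x≤y = trans (∧-comm y x) x≤y

  ≤-reflexive : ∀ {x y} → x ≡ y → x ≤ y
  ≤-reflexive {x} refl = ∧-idem x

  ≤-refl : ∀ {x} → x ≤ x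
  ≤-refl = ≤-reflexive refl

  ≤-trans : ∀ {x y z} → x ≤ y → y ≤ z → x ≤ z
  ≤-trans {x} {y} {z} x≤y y≤z = begin
    x ∧ z             ≡⟨ cong (x ∧_) (≤⇒∨≡ y≤z) ⟨
    x ∧ (y ∨ z)       ≡⟨ ∧-distribˡ-∨ x y z ⟩
    (x ∧ y) ∨ (x ∧ z) ≡⟨ cong (_∨ (x ∧ z)) x≤y ⟩
    x ∨ (x ∧ z)       ≡⟨ ∨-absorbs-∧ x z ⟩
    x                 ∎
    where open ≡-Reasoning

  ≤-antisym : ∀ {x y} → x ≤ y → y ≤ x → x ≡ y
  ≤-antisym {x} {y} x≤y y≤x = trans (sym x≤y) (trans (∧-comm x y) y≤x)

  x∧y≤x : ∀ {x y} → (x ∧ y) ≤ x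
  x∧y≤x {x} {y} = trans (∧-comm (x ∧ y) x) (∧-contract x y)

  x∧y≤y : ∀ {x y} → (x ∧ y) ≤ y
  x∧y≤y {x} {y} = subst (_≤ y) (∧-comm y x) x∧y≤x

  ∧-greatest : ∀ {x y z} → z ≤ x → z ≤ y → z ≤ (x ∧ y)
  ∧-greatest {x} {y} {z} z≤x z≤y = ∨≡⇒≤ (begin
    z ∨ (x ∧ y)       ≡⟨ cong₂ _∨_ (≤⇒∧≡ʳ z≤y) (∧-comm y x) ⟨
    (y ∧ z) ∨ (y ∧ x) ≡⟨ ∧-distribˡ-∨ y z x ⟨
    y ∧ (z ∨ x)       ≡⟨ cong (y ∧_) (≤⇒∨≡ z≤x) ⟩
    y ∧ x             ≡⟨ ∧-comm y x ⟩
    x ∧ y             ∎)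
    where open ≡-Reasoning

  x≤x∨y : ∀ {x y} → x ≤ (x ∨ y)
  x≤x∨y {x} {y} = absorb x y

  y≤x∨y : ∀ {x y} → y ≤ (x ∨ y)
  y≤x∨y {x} {y} = ∧-absorbs-∨ʳ y x

  ∨-least : ∀ {x y z} → x ≤ z → y ≤ z → (x ∨ y) ≤ z
  ∨-least {x} {y} {z} x≤z y≤z = begin
    (x ∨ y) ∧ z       ≡⟨ ∧-comm _ _ ⟩
    z ∧ (x ∨ y)       ≡⟨ ∧-distribˡ-∨ z x y ⟩
    (z ∧ x) ∨ (z ∧ y) ≡⟨ cong₂ _∨_ (≤⇒∧≡ʳ x≤z) (≤⇒∧≡ʳ y≤z) ⟩
    x ∨ y             ∎
    where open ≡-Reasoning

  ∧-mono-≤ : ∀ {x y u v} → x ≤ y → u ≤ v → (x ∧ u) ≤ (y ∧ v)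
  ∧-mono-≤ x≤y u≤v = ∧-greatest (≤-trans x∧y≤x x≤y) (≤-trans x∧y≤y u≤v)

  ∨-mono-≤ : ∀ {x y u v} → x ≤ y → u ≤ v → (x ∨ u) ≤ (y ∨ v)
  ∨-mono-≤ x≤y u≤v = ∨-least (≤-trans x≤y x≤x∨y) (≤-trans u≤v y≤x∨y)

  ∧-assoc : Associative _∧_
  ∧-assoc x y z = ≤-antisym
    (∧-greatest (≤-trans x∧y≤x x∧y≤x) (∧-mono-≤ x∧y≤y ≤-refl))
    (∧-greatest (∧-mono-≤ ≤-refl x∧y≤x) (≤-trans x∧y≤y x∧y≤y))

  ∧-distribˡ-∨-≤ : ∀ {x y z} → (x ∧ (y ∨ z)) ≤ ((x ∧ y) ∨ (x ∧ z))
  ∧-distribˡ-∨-≤ = ≤-reflexive (∧-distribˡ-∨ _ _ _)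

  ∨-distribˡ-∧-≤ : ∀ {x y z} → ((x ∨ y) ∧ (x ∨ z)) ≤ (x ∨ (y ∧ z))
  ∨-distribˡ-∧-≤ = ≤-trans ∧-distribˡ-∨-≤ (∨-least
    (≤-trans x∧y≤y x≤x∨y)
    (≤-trans (≤-reflexive (∧-comm _ _)) (≤-trans ∧-distribˡ-∨-≤
      (∨-mono-≤ x∧y≤y (≤-reflexive (∧-comm _ _))))))

  ∧-interchange : Interchangable _∧_ _∧_
  ∧-interchange w x y z = ≤-antisym
    (∧-greatest (∧-mono-≤ x∧y≤x x∧y≤x) (∧-mono-≤ x∧y≤y x∧y≤y))
    (∧-greatest (∧-mono-≤ x∧y≤x x∧y≤x) (∧-mono-≤ x∧y≤y x∧y≤y))

module NelsonAlgebraProperties {a} (N : NelsonAlgebra a) where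
  open NelsonAlgebra N
  open SholanderLattice _∧_ _∨_ N1 N2

  ∼-antitone : ∀ {x y} → x ≤ y → ∼ y ≤ ∼ x
  ∼-antitone {x} {y} x≤y = ∨≡⇒≤ (trans (∨-comm (∼ y) (∼ x)) (trans (sym (N4 x y)) (cong ∼_ x≤y)))

  ∼-∨ : ∀ x y → ∼ (x ∨ y) ≡ ∼ x ∧ ∼ y
  ∼-∨ x y = begin
    ∼ (x ∨ y)         ≡⟨ cong ∼_ (cong₂ _∨_ (N3 x) (N3 y)) ⟨
    ∼ (∼ ∼ x ∨ ∼ ∼ y) ≡⟨ cong ∼_ (N4 (∼ x) (∼ y)) ⟨
    ∼ ∼ (∼ x ∧ ∼ y)   ≡⟨ N3 _ ⟩
    ∼ x ∧ ∼ y         ∎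
    where open ≡-Reasoning

  ∼-∼∨ : ∀ x y → ∼ (∼ x ∨ y) ≡ x ∧ ∼ y
  ∼-∼∨ x y = trans (∼-∨ (∼ x) y) (cong (_∧ ∼ y) (N3 x))

  ∼-∧∼ : ∀ x y → ∼ (x ∧ ∼ y) ≡ ∼ x ∨ y
  ∼-∧∼ x y = trans (N4 x (∼ y)) (cong (∼ x ∨_) (N3 y))

  x≤𝟏 : ∀ {x} → x ≤ 𝟏
  x≤𝟏 {x} = trans (cong (x ∧_) (sym (N6 x))) (trans (N7 x x) y≤x∨y)

  𝟎≤x : ∀ {x} → 𝟎 ≤ x
  𝟎≤x {x} = subst (𝟎 ≤_) (N3 x) (∼-antitone x≤𝟏)

  -- The preorder of the Heyting reduct: by (N7), x ⊑ y iff x ≤ x ⇒ y, iff x ⇒ y ≡ 𝟏.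
  infix 4 _⊑_
  _⊑_ : Carrier → Carrier → Set a
  x ⊑ y = x ≤ ∼ x ∨ y

  ≤⇒⊑ : ∀ {x y} → x ≤ y → x ⊑ y
  ≤⇒⊑ x≤y = ≤-trans x≤y y≤x∨y

  ⊑-refl : ∀ {x} → x ⊑ x
  ⊑-refl = ≤⇒⊑ ≤-refl

  ⊑⇒∧∼≤∼ : ∀ {x y} → x ⊑ y → x ∧ ∼ y ≤ ∼ x
  ⊑⇒∧∼≤∼ {x} {y} x⊑y = subst (_≤ ∼ x) (∼-∼∨ x y) (∼-antitone x⊑y)

  ⊑-split : ∀ {x y} → x ⊑ y → x ≤ (x ∧ ∼ x) ∨ y
  ⊑-split x⊑y = ≤-trans (∧-greatest ≤-refl x⊑y) (≤-trans ∧-distribˡ-∨-≤ (∨-mono-≤ ≤-refl x∧y≤y))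

  ⊑-trans : ∀ {x y z} → x ⊑ y → y ⊑ z → x ⊑ z
  ⊑-trans x⊑y y⊑z = ≤-trans (∧-greatest ≤-refl x⊑y) (≤-trans ∧-distribˡ-∨-≤ (∨-least
    (≤-trans x∧y≤y x≤x∨y)
    (≤-trans (∧-mono-≤ ≤-refl y⊑z) (≤-trans ∧-distribˡ-∨-≤ (∨-mono-≤ (⊑⇒∧∼≤∼ x⊑y) x∧y≤y)))))

  ⊑-∧-greatest : ∀ {x y z} → z ⊑ x → z ⊑ y → z ⊑ x ∧ y
  ⊑-∧-greatest z⊑x z⊑y = ≤-trans (∧-greatest z⊑x z⊑y) ∨-distribˡ-∧-≤

  -- The crux is x ∧ ∼ x ≤ ∼ y ∨ z: by Kleene's law (N5) it lies below y ∨ ∼ y, and y ⊑ z.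
  ⊑-∨-least : ∀ {x y z} → x ⊑ z → y ⊑ z → x ∨ y ⊑ z
  ⊑-∨-least {x} {y} {z} x⊑z y⊑z = subst (λ w → x ∨ y ≤ w ∨ z) (sym (∼-∨ x y))
    (∨-least (split x⊑z y⊑z) (subst (λ w → y ≤ w ∨ z) (∧-comm _ _) (split y⊑z x⊑z)))
    where
    split : ∀ {u v} → u ⊑ z → v ⊑ z → u ≤ (∼ u ∧ ∼ v) ∨ z
    split {u} {v} u⊑z v⊑z = ≤-trans (⊑-split u⊑z) (∨-least
      (≤-trans (∧-greatest x∧y≤y (≤-trans (sym (N5 u v)) (∨-least v⊑z x≤x∨y)))
               (≤-trans ∧-distribˡ-∨-≤ (∨-mono-≤ ≤-refl x∧y≤y)))
      y≤x∨y)

  x∧∼x⊑y : ∀ {x y} → x ∧ ∼ x ⊑ y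
  x∧∼x⊑y {x} {y} = subst (λ w → x ∧ ∼ x ≤ w ∨ y) (sym (∼-∧∼ x x)) (≤-trans x∧y≤y (≤-trans x≤x∨y x≤x∨y))

  ⇒-contract : ∀ x y → x ⇒ (x ⇒ y) ≡ x ⇒ y
  ⇒-contract x y = trans (sym (N8 x x y)) (cong (_⇒ y) (∧-idem x))

  x⇒𝟏≡𝟏 : ∀ x → x ⇒ 𝟏 ≡ 𝟏
  x⇒𝟏≡𝟏 x = trans (cong (x ⇒_) (sym (N6 x))) (trans (⇒-contract x x) (N6 x))

  ⊑⇒⇒≡𝟏 : ∀ {x y} → x ⊑ y → x ⇒ y ≡ 𝟏
  ⊑⇒⇒≡𝟏 {x} {y} x⊑y = begin
    x ⇒ y                   ≡⟨ ⇒-contract x y ⟨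
    x ⇒ (x ⇒ y)             ≡⟨ cong (_⇒ (x ⇒ y)) (trans (N7 x y) x⊑y) ⟨
    (x ∧ (x ⇒ y)) ⇒ (x ⇒ y) ≡⟨ N8 _ _ _ ⟩
    x ⇒ ((x ⇒ y) ⇒ (x ⇒ y)) ≡⟨ cong (x ⇒_) (N6 _) ⟩
    x ⇒ 𝟏                   ≡⟨ x⇒𝟏≡𝟏 x ⟩
    𝟏                       ∎
    where open ≡-Reasoning

  ⇒≡𝟏⇒⊑ : ∀ {x y} → x ⇒ y ≡ 𝟏 → x ⊑ y
  ⇒≡𝟏⇒⊑ {x} {y} x⇒y≡𝟏 = trans (sym (N7 x y)) (trans (cong (x ∧_) x⇒y≡𝟏) x≤𝟏)

  ⊑-curry : ∀ {x y z} → z ∧ x ⊑ y → z ⊑ x ⇒ y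
  ⊑-curry {x} {y} {z} z∧x⊑y = ⇒≡𝟏⇒⊑ (trans (sym (N8 z x y)) (⊑⇒⇒≡𝟏 z∧x⊑y))

  ⊑-uncurry : ∀ {x y z} → z ⊑ x ⇒ y → z ∧ x ⊑ y
  ⊑-uncurry {x} {y} {z} z⊑x⇒y = ⇒≡𝟏⇒⊑ (trans (N8 z x y) (⊑⇒⇒≡𝟏 z⊑x⇒y))

  ⇒-modus-ponens : ∀ {x y} → (x ⇒ y) ∧ x ⊑ y
  ⇒-modus-ponens = ⊑-uncurry ⊑-refl

  -- Kleene's law splits x ∧ ∼ x along y ∨ ∼ y; the ∼ y half lies below y by contraposition.
  ⊑-to-≤ : ∀ {x y} → x ⊑ y → ∼ y ⊑ ∼ x → x ≤ y
  ⊑-to-≤ {x} {y} x⊑y ∼y⊑∼x = ≤-trans (⊑-split x⊑y) (∨-least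
    (≤-trans (∧-greatest ≤-refl (sym (N5 x y))) (≤-trans ∧-distribˡ-∨-≤ (∨-least x∧y≤y
       (≤-trans (∧-greatest x∧y≤y (≤-trans x∧y≤x x∧y≤x)) ∼y∧x≤y))))
    ≤-refl)
    where
    ∼y∧x≤y : ∼ y ∧ x ≤ y
    ∼y∧x≤y = subst₂ (λ u v → ∼ y ∧ u ≤ v) (N3 x) (N3 y) (⊑⇒∧∼≤∼ ∼y⊑∼x)

  ⊑-reflexive : ∀ {x y} → x ≡ y → x ⊑ y
  ⊑-reflexive x≡y = ≤⇒⊑ (≤-reflexive x≡y)

  infix 4 _≋_
  _≋_ : Carrier → Carrier → Set a
  x ≋ y = x ⊑ y × y ⊑ x

  ≋-isEquivalence : IsEquivalence _≋_
  ≋-isEquivalence = record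
    { refl  = ⊑-refl , ⊑-refl
    ; sym   = swap
    ; trans = λ (x⊑y , y⊑x) (y⊑z , z⊑y) → ⊑-trans x⊑y y⊑z , ⊑-trans z⊑y y⊑x
    }

  ⊑-isPreorder : IsPreorder _≋_ _⊑_
  ⊑-isPreorder = record { isEquivalence = ≋-isEquivalence ; reflexive = proj₁ ; trans = ⊑-trans }

  ⊑-preorder : Preorder a a a
  ⊑-preorder = record { isPreorder = ⊑-isPreorder }

  module ⊑-Reasoning = Relation.Binary.Reasoning.Preorder ⊑-preorder

  ≋-refl : ∀ {x} → x ≋ x
  ≋-refl = IsEquivalence.refl ≋-isEquivalence

  ≋⇒≡ : ∀ {x y} → x ≋ y → ∼ x ≋ ∼ y → x ≡ y
  ≋⇒≡ (x⊑y , y⊑x) (∼x⊑∼y , ∼y⊑∼x) = ≤-antisym (⊑-to-≤ x⊑y ∼y⊑∼x) (⊑-to-≤ y⊑x ∼x⊑∼y)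

  ∧-mono-⊑ : ∀ {x y u v} → x ⊑ y → u ⊑ v → x ∧ u ⊑ y ∧ v
  ∧-mono-⊑ x⊑y u⊑v = ⊑-∧-greatest (⊑-trans (≤⇒⊑ x∧y≤x) x⊑y) (⊑-trans (≤⇒⊑ x∧y≤y) u⊑v)

  ∨-mono-⊑ : ∀ {x y u v} → x ⊑ y → u ⊑ v → x ∨ u ⊑ y ∨ v
  ∨-mono-⊑ x⊑y u⊑v = ⊑-∨-least (⊑-trans x⊑y (≤⇒⊑ x≤x∨y)) (⊑-trans u⊑v (≤⇒⊑ y≤x∨y))

  ∧-cong-≋ : ∀ {x y u v} → x ≋ y → u ≋ v → x ∧ u ≋ y ∧ v
  ∧-cong-≋ (x⊑y , y⊑x) (u⊑v , v⊑u) = ∧-mono-⊑ x⊑y u⊑v , ∧-mono-⊑ y⊑x v⊑u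

  ∨-cong-≋ : ∀ {x y u v} → x ≋ y → u ≋ v → x ∨ u ≋ y ∨ v
  ∨-cong-≋ (x⊑y , y⊑x) (u⊑v , v⊑u) = ∨-mono-⊑ x⊑y u⊑v , ∨-mono-⊑ y⊑x v⊑u

  ⇒-mono-⊑ : ∀ {x x′ y y′} → x′ ⊑ x → y ⊑ y′ → x ⇒ y ⊑ x′ ⇒ y′
  ⇒-mono-⊑ x′⊑x y⊑y′ = ⊑-curry (⊑-trans (∧-mono-⊑ ⊑-refl x′⊑x) (⊑-trans ⇒-modus-ponens y⊑y′))

  ∼x∧x⊑y : ∀ {x y} → ∼ x ∧ x ⊑ y
  ∼x∧x⊑y = ⊑-trans (⊑-reflexive (∧-comm _ _)) x∧∼x⊑y

  -- Negating (N7) gives ∼ x ∨ ∼ (x ⇒ y) ≡ ∼ x ∨ (x ∧ ∼ y), and on either side the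
  -- disjunct ∼ x is inconsistent with the rest.
  ∼⇒-≋ : ∀ {x y} → ∼ (x ⇒ y) ≋ x ∧ ∼ y
  ∼⇒-≋ {x} {y} = ∼[x⇒y]⊑x∧∼y , x∧∼y⊑∼[x⇒y]
    where
    open ⊑-Reasoning
    ∼N7 : ∼ x ∨ ∼ (x ⇒ y) ≡ ∼ x ∨ (x ∧ ∼ y)
    ∼N7 = trans (sym (N4 _ _)) (trans (cong ∼_ (N7 x y)) (trans (N4 _ _) (cong (∼ x ∨_) (∼-∼∨ x y))))

    ∼[x⇒y]⊑x∧∼y : ∼ (x ⇒ y) ⊑ x ∧ ∼ y
    ∼[x⇒y]⊑x∧∼y = begin
      ∼ (x ⇒ y)                                       ≲⟨ ≤⇒⊑ (∧-greatest ≤-refl (≤-trans y≤x∨y (≤-reflexive ∼N7))) ⟩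
      ∼ (x ⇒ y) ∧ (∼ x ∨ (x ∧ ∼ y))                   ≲⟨ ≤⇒⊑ ∧-distribˡ-∨-≤ ⟩
      (∼ (x ⇒ y) ∧ ∼ x) ∨ (∼ (x ⇒ y) ∧ (x ∧ ∼ y))     ≲⟨ ⊑-∨-least ∼[x⇒y]∧∼x⊑x∧∼y (≤⇒⊑ x∧y≤y) ⟩
      x ∧ ∼ y                                         ∎
      where
      ∼[x⇒y]∧∼x⊑x∧∼y : ∼ (x ⇒ y) ∧ ∼ x ⊑ x ∧ ∼ y
      ∼[x⇒y]∧∼x⊑x∧∼y = ⊑-trans (∧-mono-⊑ ⊑-refl (⊑-curry ∼x∧x⊑y)) ∼x∧x⊑y

    x∧∼y⊑∼[x⇒y] : x ∧ ∼ y ⊑ ∼ (x ⇒ y)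
    x∧∼y⊑∼[x⇒y] = begin
      x ∧ ∼ y                       ≲⟨ ≤⇒⊑ (∧-greatest x∧y≤x (≤-trans y≤x∨y (≤-reflexive (sym ∼N7)))) ⟩
      x ∧ (∼ x ∨ ∼ (x ⇒ y))         ≲⟨ ≤⇒⊑ ∧-distribˡ-∨-≤ ⟩
      (x ∧ ∼ x) ∨ (x ∧ ∼ (x ⇒ y))   ≲⟨ ⊑-∨-least x∧∼x⊑y (≤⇒⊑ x∧y≤y) ⟩
      ∼ (x ⇒ y)                     ∎

  ∼x≤x⇒y : ∀ {x y} → ∼ x ≤ x ⇒ y
  ∼x≤x⇒y {x} = ⊑-to-≤ (⊑-curry ∼x∧x⊑y) (⊑-trans (proj₁ ∼⇒-≋) (≤⇒⊑ (≤-trans x∧y≤x (≤-reflexive (sym (N3 x))))))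

  x≤∼x⇒y : ∀ {x y} → x ≤ ∼ x ⇒ y
  x≤∼x⇒y {x} = subst (_≤ ∼ x ⇒ _) (N3 x) ∼x≤x⇒y

  y≤x⇒y : ∀ {x y} → y ≤ x ⇒ y
  y≤x⇒y = ⊑-to-≤ (⊑-curry (≤⇒⊑ x∧y≤x)) (⊑-trans (proj₁ ∼⇒-≋) (≤⇒⊑ x∧y≤y))

  𝟏⇒x≡x : ∀ x → 𝟏 ⇒ x ≡ x
  𝟏⇒x≡x x = begin
    𝟏 ⇒ x       ≡⟨ ≤⇒∧≡ʳ x≤𝟏 ⟨
    𝟏 ∧ (𝟏 ⇒ x) ≡⟨ N7 𝟏 x ⟩
    𝟏 ∧ (𝟎 ∨ x) ≡⟨ ≤⇒∧≡ʳ x≤𝟏 ⟩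
    𝟎 ∨ x       ≡⟨ ≤⇒∨≡ 𝟎≤x ⟩
    x           ∎
    where open ≡-Reasoning

  ⇒-distribˡ-∧ : ∀ x y z → x ⇒ (y ∧ z) ≡ (x ⇒ y) ∧ (x ⇒ z)
  ⇒-distribˡ-∧ x y z = ≋⇒≡
    ( ⊑-∧-greatest (⇒-mono-⊑ ⊑-refl (≤⇒⊑ x∧y≤x)) (⇒-mono-⊑ ⊑-refl (≤⇒⊑ x∧y≤y))
    , ⊑-curry (⊑-∧-greatest (⊑-trans (∧-mono-⊑ (≤⇒⊑ x∧y≤x) ⊑-refl) ⇒-modus-ponens)
                            (⊑-trans (∧-mono-⊑ (≤⇒⊑ x∧y≤y) ⊑-refl) ⇒-modus-ponens)))
    (begin-equality
      ∼ (x ⇒ (y ∧ z))       ≈⟨ ∼⇒-≋ ⟩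
      x ∧ ∼ (y ∧ z)         ≡⟨ cong (x ∧_) (N4 y z) ⟩
      x ∧ (∼ y ∨ ∼ z)       ≡⟨ ∧-distribˡ-∨ x (∼ y) (∼ z) ⟩
      (x ∧ ∼ y) ∨ (x ∧ ∼ z) ≈⟨ ∨-cong-≋ ∼⇒-≋ ∼⇒-≋ ⟨
      ∼ (x ⇒ y) ∨ ∼ (x ⇒ z) ≡⟨ N4 _ _ ⟨
      ∼ ((x ⇒ y) ∧ (x ⇒ z)) ∎)
    where open ⊑-Reasoning

  ⇒-antidistribˡ-∨ : ∀ x y z → (x ∨ y) ⇒ z ≡ (x ⇒ z) ∧ (y ⇒ z)
  ⇒-antidistribˡ-∨ x y z = ≋⇒≡
    ( ⊑-∧-greatest (⇒-mono-⊑ (≤⇒⊑ x≤x∨y) ⊑-refl) (⇒-mono-⊑ (≤⇒⊑ y≤x∨y) ⊑-refl)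
    , ⊑-curry (⊑-trans (⊑-reflexive (∧-distribˡ-∨ _ x y)) (⊑-∨-least
        (⊑-trans (∧-mono-⊑ (≤⇒⊑ x∧y≤x) ⊑-refl) ⇒-modus-ponens)
        (⊑-trans (∧-mono-⊑ (≤⇒⊑ x∧y≤y) ⊑-refl) ⇒-modus-ponens))))
    (begin-equality
      ∼ ((x ∨ y) ⇒ z)       ≈⟨ ∼⇒-≋ ⟩
      (x ∨ y) ∧ ∼ z         ≡⟨ ∧-distribʳ-∨ (∼ z) x y ⟩
      (x ∧ ∼ z) ∨ (y ∧ ∼ z) ≈⟨ ∨-cong-≋ ∼⇒-≋ ∼⇒-≋ ⟨
      ∼ (x ⇒ z) ∨ ∼ (y ⇒ z) ≡⟨ N4 _ _ ⟨
      ∼ ((x ⇒ z) ∧ (y ⇒ z)) ∎)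
    where open ⊑-Reasoning

  ↣-intro : ∀ {t u v} → t ∧ u ⊑ v → t ∧ ∼ v ⊑ ∼ u → t ⊑ u ↣ v
  ↣-intro t∧u⊑v t∧∼v⊑∼u = ⊑-∧-greatest (⊑-curry t∧u⊑v) (⊑-curry t∧∼v⊑∼u)

  ↣-elim₁ : ∀ {t u v} → t ⊑ u ↣ v → t ∧ u ⊑ v
  ↣-elim₁ t⊑u↣v = ⊑-uncurry (⊑-trans t⊑u↣v (≤⇒⊑ x∧y≤x))

  ↣-elim₂ : ∀ {t u v} → t ⊑ u ↣ v → t ∧ ∼ v ⊑ ∼ u
  ↣-elim₂ t⊑u↣v = ⊑-uncurry (⊑-trans t⊑u↣v (≤⇒⊑ x∧y≤y))

  ∼↣-≋ : ∀ {u v} → ∼ (u ↣ v) ≋ u ∧ ∼ v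
  ∼↣-≋ {u} {v} = begin-equality
    ∼ (u ↣ v)                 ≡⟨ N4 _ _ ⟩
    ∼ (u ⇒ v) ∨ ∼ (∼ v ⇒ ∼ u) ≈⟨ ∨-cong-≋ ∼⇒-≋ ∼⇒-≋ ⟩
    (u ∧ ∼ v) ∨ (∼ v ∧ ∼ ∼ u) ≡⟨ cong ((u ∧ ∼ v) ∨_) (trans (cong (∼ v ∧_) (N3 u)) (∧-comm (∼ v) u)) ⟩
    (u ∧ ∼ v) ∨ (u ∧ ∼ v)     ≡⟨ ∨-idem _ ⟩
    u ∧ ∼ v                   ∎
    where open ⊑-Reasoning

  ∼↣↣-≋ : ∀ {u w} → ∼ (u ↣ (u ↣ w)) ≋ u ∧ ∼ w
  ∼↣↣-≋ {u} {w} = begin-equality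
    ∼ (u ↣ (u ↣ w)) ≈⟨ ∼↣-≋ ⟩
    u ∧ ∼ (u ↣ w)   ≈⟨ ∧-cong-≋ ≋-refl ∼↣-≋ ⟩
    u ∧ (u ∧ ∼ w)   ≡⟨ ∧-contract u (∼ w) ⟩
    u ∧ ∼ w         ∎
    where open ⊑-Reasoning

  ↣↣-intro : ∀ {t u w} → t ∧ u ⊑ w → (t ∧ u) ∧ ∼ w ⊑ 𝟎 → t ⊑ u ↣ (u ↣ w)
  ↣↣-intro {t} {u} {w} t∧u⊑w t∧u∧∼w⊑𝟎 = ↣-intro
    (↣-intro (⊑-trans (⊑-reflexive x∧y≤y) t∧u⊑w) (⊑-trans t∧u∧∼w⊑𝟎 (≤⇒⊑ 𝟎≤x)))
    (begin
      t ∧ ∼ (u ↣ w) ≲⟨ ∧-mono-⊑ ⊑-refl (proj₁ ∼↣-≋) ⟩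
      t ∧ (u ∧ ∼ w) ≡⟨ ∧-assoc t u (∼ w) ⟨
      (t ∧ u) ∧ ∼ w ≲⟨ t∧u∧∼w⊑𝟎 ⟩
      𝟎             ≲⟨ ≤⇒⊑ 𝟎≤x ⟩
      ∼ u           ∎)
    where open ⊑-Reasoning

  ↣↣-elim₁ : ∀ {t u w} → t ⊑ u ↣ (u ↣ w) → t ∧ u ⊑ w
  ↣↣-elim₁ {t} {u} t⊑u↣u↣w = ⊑-trans (⊑-reflexive (sym x∧y≤y)) (↣-elim₁ (↣-elim₁ t⊑u↣u↣w))

  ↣↣-elim₂ : ∀ {t u w} → t ⊑ u ↣ (u ↣ w) → (t ∧ u) ∧ ∼ w ⊑ 𝟎
  ↣↣-elim₂ t⊑u↣u↣w =
    ⊑-trans (⊑-∧-greatest (≤⇒⊑ (≤-trans x∧y≤x x∧y≤y)) (↣-elim₂ (↣-elim₁ t⊑u↣u↣w))) x∧∼x⊑y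

  ∼B≡∼ : ∀ x → ∼B x ≡ ∼ x
  ∼B≡∼ x = begin
    (x ⇒ 𝟎) ∧ (∼ 𝟎 ⇒ ∼ x) ≡⟨ cong (λ u → (x ⇒ 𝟎) ∧ (u ⇒ ∼ x)) (N3 𝟏) ⟩
    (x ⇒ 𝟎) ∧ (𝟏 ⇒ ∼ x)   ≡⟨ cong ((x ⇒ 𝟎) ∧_) (𝟏⇒x≡x (∼ x)) ⟩
    (x ⇒ 𝟎) ∧ ∼ x         ≡⟨ ≤⇒∧≡ʳ ∼x≤x⇒y ⟩
    ∼ x                   ∎
    where open ≡-Reasoning

  ∨B≡∨ : ∀ x y → x ∨B y ≡ x ∨ y
  ∨B≡∨ x y = begin
    x ∨B y                ≡⟨ ∼B≡∼ _ ⟩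
    ∼ ((x ↣ 𝟎) ∧ (y ↣ 𝟎)) ≡⟨ cong ∼_ (cong₂ _∧_ (∼B≡∼ x) (∼B≡∼ y)) ⟩
    ∼ (∼ x ∧ ∼ y)         ≡⟨ N4 _ _ ⟩
    ∼ ∼ x ∨ ∼ ∼ y         ≡⟨ cong₂ _∨_ (N3 x) (N3 y) ⟩
    x ∨ y                 ∎
    where open ≡-Reasoning

  x↣x≡𝟏 : ∀ x → x ↣ x ≡ 𝟏
  x↣x≡𝟏 x = trans (cong₂ _∧_ (N6 x) (N6 (∼ x))) (∧-idem 𝟏)

  𝟏↣x≡x : ∀ x → 𝟏 ↣ x ≡ x
  𝟏↣x≡x x = trans (cong (_∧ (∼ x ⇒ 𝟎)) (𝟏⇒x≡x x)) x≤∼x⇒y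

  [x↣y]∧y≡y : ∀ x y → (x ↣ y) ∧ y ≡ y
  [x↣y]∧y≡y x y = ≤⇒∧≡ʳ (∧-greatest y≤x⇒y x≤∼x⇒y)

  x∧∼[x∧∼y]≡x∧[x↣y] : ∀ x y → x ∧ ∼ (x ∧ ∼ y) ≡ x ∧ (x ↣ y)
  x∧∼[x∧∼y]≡x∧[x↣y] x y = begin
    x ∧ ∼ (x ∧ ∼ y)                ≡⟨ cong (x ∧_) (∼-∧∼ x y) ⟩
    x ∧ (∼ x ∨ y)                  ≡⟨ N7 x y ⟨
    x ∧ (x ⇒ y)                    ≡⟨ x∧[x⇒y]≤∼y⇒∼x ⟨
    (x ∧ (x ⇒ y)) ∧ (∼ y ⇒ ∼ x)    ≡⟨ ∧-assoc _ _ _ ⟩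
    x ∧ (x ↣ y)                    ∎
    where
    open ≡-Reasoning
    x∧[x⇒y]≤∼y⇒∼x : x ∧ (x ⇒ y) ≤ ∼ y ⇒ ∼ x
    x∧[x⇒y]≤∼y⇒∼x = ≤-trans (≤-reflexive (N7 x y))
      (≤-trans ∧-distribˡ-∨-≤ (∨-least (≤-trans x∧y≤y y≤x⇒y) (≤-trans x∧y≤y x≤∼x⇒y)))

  ↣-distribˡ-∧ : ∀ x y z → x ↣ (y ∧ z) ≡ (x ↣ y) ∧ (x ↣ z)
  ↣-distribˡ-∧ x y z = begin
    (x ⇒ (y ∧ z)) ∧ (∼ (y ∧ z) ⇒ ∼ x)                 ≡⟨ cong₂ _∧_ (⇒-distribˡ-∧ x y z)
                                                           (trans (cong (_⇒ ∼ x) (N4 y z)) (⇒-antidistribˡ-∨ _ _ _)) ⟩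
    ((x ⇒ y) ∧ (x ⇒ z)) ∧ ((∼ y ⇒ ∼ x) ∧ (∼ z ⇒ ∼ x)) ≡⟨ ∧-interchange _ _ _ _ ⟩
    (x ↣ y) ∧ (x ↣ z)                                 ∎
    where open ≡-Reasoning

  ↣-contrapositive : ∀ x y → x ↣ y ≡ ∼B y ↣ ∼B x
  ↣-contrapositive x y = sym (begin
    ∼B y ↣ ∼B x                   ≡⟨ cong₂ _↣_ (∼B≡∼ y) (∼B≡∼ x) ⟩
    (∼ y ⇒ ∼ x) ∧ (∼ ∼ x ⇒ ∼ ∼ y) ≡⟨ cong₂ (λ u v → (∼ y ⇒ ∼ x) ∧ (u ⇒ v)) (N3 x) (N3 y) ⟩
    (∼ y ⇒ ∼ x) ∧ (x ⇒ y)         ≡⟨ ∧-comm _ _ ⟩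
    x ↣ y                         ∎)
    where open ≡-Reasoning

  -- Both sides have the same ⊑-lower sets, and their negations are ≋-equivalent.
  ↣↣-∧ : ∀ x y z → x ↣ (x ↣ (y ↣ (y ↣ z))) ≡ (x ∧ y) ↣ ((x ∧ y) ↣ z)
  ↣↣-∧ x y z = ≋⇒≡ (uncurried ⊑-refl , curried ⊑-refl) (begin-equality
    ∼ (x ↣ (x ↣ W))       ≈⟨ ∼↣↣-≋ ⟩
    x ∧ ∼ W               ≈⟨ ∧-cong-≋ ≋-refl ∼↣↣-≋ ⟩
    x ∧ (y ∧ ∼ z)         ≡⟨ ∧-assoc x y (∼ z) ⟨
    (x ∧ y) ∧ ∼ z         ≈⟨ ∼↣↣-≋ ⟨
    ∼ ((x ∧ y) ↣ ((x ∧ y) ↣ z)) ∎)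
    where
    open ⊑-Reasoning
    W = y ↣ (y ↣ z)

    uncurried : ∀ {t} → t ⊑ x ↣ (x ↣ W) → t ⊑ (x ∧ y) ↣ ((x ∧ y) ↣ z)
    uncurried {t} t⊑L = ↣↣-intro
      (⊑-trans (⊑-reflexive (sym (∧-assoc t x y))) (↣↣-elim₁ (↣↣-elim₁ t⊑L)))
      (⊑-trans (⊑-reflexive (cong (_∧ ∼ z) (sym (∧-assoc t x y)))) (↣↣-elim₂ (↣↣-elim₁ t⊑L)))

    curried : ∀ {t} → t ⊑ (x ∧ y) ↣ ((x ∧ y) ↣ z) → t ⊑ x ↣ (x ↣ W)
    curried {t} t⊑R = ↣↣-intro (↣↣-intro t∧x∧y⊑z t∧x∧y∧∼z⊑𝟎) (begin
      (t ∧ x) ∧ ∼ W         ≲⟨ ∧-mono-⊑ ⊑-refl (proj₁ ∼↣↣-≋) ⟩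
      (t ∧ x) ∧ (y ∧ ∼ z)   ≡⟨ ∧-assoc (t ∧ x) y (∼ z) ⟨
      ((t ∧ x) ∧ y) ∧ ∼ z   ≲⟨ t∧x∧y∧∼z⊑𝟎 ⟩
      𝟎                     ∎)
      where
      t∧x∧y⊑z : (t ∧ x) ∧ y ⊑ z
      t∧x∧y⊑z = ⊑-trans (⊑-reflexive (∧-assoc t x y)) (↣↣-elim₁ t⊑R)
      t∧x∧y∧∼z⊑𝟎 : ((t ∧ x) ∧ y) ∧ ∼ z ⊑ 𝟎
      t∧x∧y∧∼z⊑𝟎 = ⊑-trans (⊑-reflexive (cong (_∧ ∼ z) (∧-assoc t x y))) (↣↣-elim₂ t⊑R)

  ∼[∼x∧y]↣[x↣y]≡x↣y : ∀ x y → ∼ (∼ x ∧ y) ↣ (x ↣ y) ≡ x ↣ y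
  ∼[∼x∧y]↣[x↣y]≡x↣y x y = ≋⇒≡ (s↣v⊑v , ↣-intro (≤⇒⊑ x∧y≤x) x∧∼x⊑y) (begin-equality
    ∼ (s ↣ v) ≈⟨ ∼↣-≋ ⟩
    s ∧ ∼ v   ≈⟨ ≤⇒⊑ x∧y≤y , ⊑-∧-greatest ∼v⊑s ⊑-refl ⟩
    ∼ v       ∎)
    where
    open ⊑-Reasoning
    s = ∼ (∼ x ∧ y)
    v = x ↣ y

    s≡x∨∼y : s ≡ x ∨ ∼ y
    s≡x∨∼y = trans (N4 (∼ x) y) (cong (_∨ ∼ y) (N3 x))

    ↣-elim-≤ : ∀ {u} → u ≤ s → (s ↣ v) ∧ u ⊑ v
    ↣-elim-≤ u≤s = ⊑-trans (∧-mono-⊑ ⊑-refl (≤⇒⊑ u≤s)) (↣-elim₁ ⊑-refl)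

    s↣v⊑v : s ↣ v ⊑ v
    s↣v⊑v = ↣-intro
      (⊑-trans (⊑-reflexive (sym x∧y≤y)) (↣-elim₁ (↣-elim-≤ (≤-trans x≤x∨y (≤-reflexive (sym s≡x∨∼y))))))
      (⊑-trans (⊑-reflexive (sym x∧y≤y)) (↣-elim₂ (↣-elim-≤ (≤-trans y≤x∨y (≤-reflexive (sym s≡x∨∼y))))))

    ∼v⊑s : ∼ v ⊑ s
    ∼v⊑s = ⊑-trans (proj₁ ∼↣-≋) (≤⇒⊑ (≤-trans x∧y≤x (≤-trans x≤x∨y (≤-reflexive (sym s≡x∨∼y)))))

mainTheorem6 : {a : Level} (N : NelsonAlgebra a) → Theorem6 N
mainTheorem6 N x y z =
    ∼B≡∼ x
  , ∨B≡∨ x y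
  , ( trans (cong (x ∧_) (∨B≡∨ x y)) (N1 x y)
    , trans (cong (x ∧_) (∨B≡∨ y z)) (trans (N2 x y z) (sym (∨B≡∨ _ _)))
    , trans (cong₂ (λ u v → (x ∧ u) ∧ v) (∼B≡∼ x) (trans (∨B≡∨ y _) (cong (y ∨_) (∼B≡∼ y))))
        (trans (sym (N5 x y)) (cong (x ∧_) (sym (∼B≡∼ x)))))
  , x↣x≡𝟏 x
  , sym x≤∼x⇒y
  , 𝟏↣x≡x x
  , trans (cong (_↣ y) (x↣x≡𝟏 x)) (𝟏↣x≡x y)
  , [x↣y]∧y≡y x y
  , x∧∼[x∧∼y]≡x∧[x↣y] x y
  , ↣-distribˡ-∧ x y z
  , ↣-contrapositive x y
  , ↣↣-∧ x y z
  , ∼[∼x∧y]↣[x↣y]≡x↣y x y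
  where
  open NelsonAlgebra N
  open NelsonAlgebraProperties N
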